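{- For every position $X$ and every play $U\in\mathcal E_X$, the map $$\sum_{n\in\mathbb N}\sum_{M\in\mathcal M^f_n}U(M)\longrightarrow\sum_{n\in\mathbb N}U([n]),$$ given on each summand by the action of the morphism $s$ (for forking, $s$ denotes the common composite $l\circ s=r\circ s$), is injective.
   Context: Base category. Let $\mathcal C$ be the category generated by the following graph modulo relations. Objects: $\star$; $[n]$ ($n\in\mathbb N$); for each $n$: $\mathrm{tick}_n,\mathrm{paral}_n,\mathrm{parar}_n,\nu_n,\mathrm{para}_n$; for $1\le i\le n$: $\iota^+_{n,i},\iota^-_{n,i}$; for $n,m$, $1\le i\le n$, $1\le j\le m$: $\tau_{n,i,m,j}$. Arrows: $d_1,\dots,d_n\colon\star\to[n]$; $s,t\colon[n]\to c$ for $c\in\{\mathrm{tick}_n,\mathrm{paral}_n,\mathrm{parar}_n,\iota^\pm_{n,i}\}$; $s\colon[n]\to\nu_n$, $t\colon[n+1]\to\nu_n$; $l\colon\mathrm{paral}_n\to\mathrm{para}_n$, $r\colon\mathrm{parar}_n\to\mathrm{para}_n$; $\epsilon\colon\iota^+_{n,i}\to\tau_{n,i,m,j}$, $\rho\colon\iota^-_{m,j}\to\tau_{n,i,m,j}$. Relations: $s\circ d_i=t\circ d_i$ ($1\le i\le n$) for each pair $s,t$ into a common object; $l\circ s=r\circ s$; $\epsilon\circ s\circ d_i=\rho\circ s\circ d_j$. $\widehat{\mathcal C}=[\mathcal C^{op},\mathbf{Set}]$, objects identified with representables. Positions: finite presheaves empty outside $\star$ and the $[n]$ (channels / players). Moves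 (cospans in $\widehat{\mathcal C}$ with an interface, up to isomorphism): basic moves $[n]\xrightarrow{s}c\xleftarrow{t}[n']$ for $c\in\{\mathrm{tick}_n,\mathrm{paral}_n,\mathrm{parar}_n,\nu_n,\iota^\pm_{n,i}\}$ ($n'=n+1$ for $\nu_n$, else $n$), interface $n\cdot\star$ via $[d_1,\dots,d_n]$; forking: with $n|n$ the pushout of $[n]\leftarrow n\cdot\star\to[n]$ (both maps $[d_1,\dots,d_n]$), the cospan $[n]\xrightarrow{l\circ s}\mathrm{para}_n\leftarrow n|n$ (right map induced by $l\circ t$, $r\circ t$), interface $n\cdot\star$; synchronisation: with $n\bowtie_{i,j}m$ the pushout of $[n]\xleftarrow{d_i}\star\xrightarrow{d_j}[m]$, the cospan $n\bowtie_{i,j}m\xrightarrow{s'}\tau_{n,i,m,j}\xleftarrow{t'}n\bowtie_{i,j}m$ ($s'$ induced by $\epsilon\circ s,\rho\circ s$; $t'$ by $\epsilon\circ t,\rho\circ t$), interface the channels. Full moves: forking ($\mathrm{para}_n$), input ($\iota^-_{n,i}$), output ($\iota^+_{n,i}$), tick, channel creation ($\nu_n$). $\mathcal M^f_n$ is the set of isomorphism classes of full moves with initial position $[n]$; for $M\in\mathcal M^f_n$, $U(M)$ denotes $U$ evaluated at the corresponding object $\mathrm{tick}_n,\nu_n,\iota^\pm_{n,i}$ or $\mathrm{para}_n$ of $\mathcal C$. Extended moves: push a move with interface $I$ out along a morphism $I\to Z$ into a position $Z$. A play is a mono $X_0\hookrightarrow U$ with $U$ the colimit of a finite or countable chain $X_0\to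 M_0\leftarrow X_1\to M_1\leftarrow\cdots$ of extended moves. $\mathcal E_X$: plays $Y\hookrightarrow U$ with a morphism $Y\to X$. -}

module Defs where

open import Data.Nat using (ℕ; zero; suc; _≤_)
open import Data.Fin using (Fin; inject₁)
open import Data.Maybe using (Maybe; just; nothing)
open import Data.Product using (Σ; _×_; _,_)
open import Data.Sum using (_⊎_)
open import Relation.Nullary using (¬_)
open import Relation.Binary.PropositionalEquality using (_≡_)
open import Function.Bundles using (_↔_)
open import Function.Definitions using (Injective)

-- The base category C, presented by generators and relations.
-- Indices 1 ≤ i ≤ n are represented by  i : Fin n  (i ↦ toℕ i + 1).

-- Shapes c with two arrows s, t : [n] → c  (tick_n, paral_n, parar_n, ι⁺_{n,i}, ι⁻_{n,i})
data Bas (n : ℕ) : Set where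
  btick bparal bparar : Bas n
  bout bin : Fin n → Bas n

data Ob : Set where
  ⋆ : Ob
  [_] : ℕ → Ob
  tick paral parar ν para : ℕ → Ob
  ι⁺ ι⁻ : (n : ℕ) → Fin n → Ob
  τ : (n : ℕ) → Fin n → (m : ℕ) → Fin m → Ob

obB : ∀ {n} → Bas n → Ob
obB {n} btick = tick n
obB {n} bparal = paral n
obB {n} bparar = parar n
obB {n} (bout i) = ι⁺ n i
obB {n} (bin i) = ι⁻ n i

data Gen : Ob → Ob → Set where
  d : ∀ {n} → Fin n → Gen ⋆ [ n ]
  sB tB : ∀ {n} (c : Bas n) → Gen [ n ] (obB c)
  sν : ∀ {n} → Gen [ n ] (ν n)
  tν : ∀ {n} → Gen [ suc n ] (ν n)
  l : ∀ {n} → Gen (paral n) (para n)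
  r : ∀ {n} → Gen (parar n) (para n)
  ε : ∀ {n i m j} → Gen (ι⁺ n i) (τ n i m j)
  ρ : ∀ {n i m j} → Gen (ι⁻ m j) (τ n i m j)

-- Presheaves on C (functors C^op → Set), i.e. an action of the
-- generators respecting the relations of C.

record Presheaf : Set₁ where
  field
    F   : Ob → Set
    act : ∀ {a b} → Gen a b → F b → F a
    relB : ∀ {n} (c : Bas n) (i : Fin n) (x : F (obB c)) →
           act (d i) (act (sB c) x) ≡ act (d i) (act (tB c) x)
    relν : ∀ {n} (i : Fin n) (x : F (ν n)) →
           act (d i) (act sν x) ≡ act (d (inject₁ i)) (act tν x)
    rellr : ∀ {n} (x : F (para n)) →
            act (sB bparal) (act l x) ≡ act (sB bparar) (act r x)
    relτ : ∀ {n i m j} (x : F (τ n i m j)) →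
           act (d i) (act (sB (bout i)) (act (ε {n} {i} {m} {j}) x))
           ≡ act (d j) (act (sB (bin j)) (act (ρ {n} {i} {m} {j}) x))

open Presheaf public

record Mor (P Q : Presheaf) : Set where
  field
    ap  : ∀ {a} → F P a → F Q a
    nat : ∀ {a b} (g : Gen a b) (x : F P b) → ap (act P g x) ≡ act Q g (ap x)

open Mor public

_∘ₘ_ : ∀ {P Q R} → Mor Q R → Mor P Q → Mor P R
ap (g ∘ₘ f) x = ap g (ap f x)
nat (_∘ₘ_ {P} {Q} {R} g f) h x rewrite nat f h x = nat g h (ap f x)

_≈ₘ_ : ∀ {P Q} → Mor P Q → Mor P Q → Set
_≈ₘ_ {P} f g = ∀ (a : Ob) (x : F P a) → ap f x ≡ ap g x

Monic : ∀ {P Q} → Mor P Q → Set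
Monic {P} f = ∀ (a : Ob) → Injective _≡_ _≡_ (ap f {a})

-- P is the representable presheaf y(c), with universal element p ∈ P(c)
record IsRep (P : Presheaf) (c : Ob) (p : F P c) : Set₁ where
  field
    exist  : ∀ (W : Presheaf) (w : F W c) → Σ (Mor P W) (λ h → ap h p ≡ w)
    unique : ∀ (W : Presheaf) (h h' : Mor P W) → ap h p ≡ ap h' p → h ≈ₘ h'

-- P is the coproduct n·⋆ of n copies of ⋆, with injections e
record IsCopStar (P : Presheaf) (n : ℕ) (e : Fin n → F P ⋆) : Set₁ where
  field
    exist  : ∀ (W : Presheaf) (w : Fin n → F W ⋆) →
             Σ (Mor P W) (λ h → ∀ i → ap h (e i) ≡ w i)
    unique : ∀ (W : Presheaf) (h h' : Mor P W) →
             (∀ i → ap h (e i) ≡ ap h' (e i)) → h ≈ₘ h'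

record IsPushout {B A C P : Presheaf} (f : Mor B A) (g : Mor B C)
                 (i : Mor A P) (j : Mor C P) : Set₁ where
  field
    commute : (i ∘ₘ f) ≈ₘ (j ∘ₘ g)
    exist   : ∀ (W : Presheaf) (u : Mor A W) (v : Mor C W) → (u ∘ₘ f) ≈ₘ (v ∘ₘ g) →
              Σ (Mor P W) (λ h → ((h ∘ₘ i) ≈ₘ u) × ((h ∘ₘ j) ≈ₘ v))
    unique  : ∀ (W : Presheaf) (h h' : Mor P W) →
              (h ∘ₘ i) ≈ₘ (h' ∘ₘ i) → (h ∘ₘ j) ≈ₘ (h' ∘ₘ j) → h ≈ₘ h'

-- n|n : pushout of [n] ← n·⋆ → [n] (both maps [d_1,…,d_n]);
-- b₁, b₂ are the images of the universal elements of the two copies of [n]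
record IsParPar (P : Presheaf) (n : ℕ) (b₁ b₂ : F P [ n ]) : Set₁ where
  field
    J R₁ R₂ : Presheaf
    e  : Fin n → F J ⋆
    cop : IsCopStar J n e
    r₁ : F R₁ [ n ]
    r₂ : F R₂ [ n ]
    rep₁ : IsRep R₁ [ n ] r₁
    rep₂ : IsRep R₂ [ n ] r₂
    f₁ : Mor J R₁
    f₂ : Mor J R₂
    f₁-e : ∀ i → ap f₁ (e i) ≡ act R₁ (d i) r₁
    f₂-e : ∀ i → ap f₂ (e i) ≡ act R₂ (d i) r₂
    i₁ : Mor R₁ P
    i₂ : Mor R₂ P
    po : IsPushout f₁ f₂ i₁ i₂
    i₁-r : ap i₁ r₁ ≡ b₁
    i₂-r : ap i₂ r₂ ≡ b₂

-- n ⋈_{i,j} m : pushout of [n] ←d_i− ⋆ −d_j→ [m]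
record IsBowtie (P : Presheaf) (n : ℕ) (i : Fin n) (m : ℕ) (j : Fin m)
                (p : F P [ n ]) (q : F P [ m ]) : Set₁ where
  field
    S Rn Rm : Presheaf
    s₀ : F S ⋆
    repS : IsRep S ⋆ s₀
    rn : F Rn [ n ]
    rm : F Rm [ m ]
    repn : IsRep Rn [ n ] rn
    repm : IsRep Rm [ m ] rm
    fn : Mor S Rn
    fm : Mor S Rm
    fn-s : ap fn s₀ ≡ act Rn (d i) rn
    fm-s : ap fm s₀ ≡ act Rm (d j) rm
    iₙ : Mor Rn P
    iₘ : Mor Rm P
    po : IsPushout fn fm iₙ iₘ
    iₙ-r : ap iₙ rn ≡ p
    iₘ-r : ap iₘ rm ≡ q

-- Moves: cospans  A --am--> M <--bm-- B  with interface I (ia : I → A, ib : I → B)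

record Cospan : Set₁ where
  field
    I A M B : Presheaf
    ia : Mor I A
    ib : Mor I B
    am : Mor A M
    bm : Mor B M

data BasicKind (n : ℕ) : Set where
  bas : Bas n → BasicKind n
  new : BasicKind n

obK : ∀ {n} → BasicKind n → Ob
obK (bas c) = obB c
obK {n} new = ν n

arK : ∀ {n} → BasicKind n → ℕ
arK {n} (bas c) = n
arK {n} new = suc n

sK : ∀ {n} (k : BasicKind n) → Gen [ n ] (obK k)
sK (bas c) = sB c
sK new = sν

tK : ∀ {n} (k : BasicKind n) → Gen [ arK k ] (obK k)
tK (bas c) = tB c
tK new = tν

embK : ∀ {n} (k : BasicKind n) → Fin n → Fin (arK k)
embK (bas c) i = i
embK new i = inject₁ i

record IsBasicMove (C : Cospan) (n : ℕ) (k : BasicKind n) : Set₁ where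
  open Cospan C
  field
    m : F M (obK k)
    repM : IsRep M (obK k) m
    a : F A [ n ]
    repA : IsRep A [ n ] a
    b : F B [ arK k ]
    repB : IsRep B [ arK k ] b
    e : Fin n → F I ⋆
    copI : IsCopStar I n e
    am-a : ap am a ≡ act M (sK k) m
    bm-b : ap bm b ≡ act M (tK k) m
    ia-e : ∀ i → ap ia (e i) ≡ act A (d i) a
    ib-e : ∀ i → ap ib (e i) ≡ act B (d (embK k i)) b

record IsFork (C : Cospan) (n : ℕ) : Set₁ where
  open Cospan C
  field
    m : F M (para n)
    repM : IsRep M (para n) m
    a : F A [ n ]
    repA : IsRep A [ n ] a
    b₁ b₂ : F B [ n ]
    parB : IsParPar B n b₁ b₂
    e : Fin n → F I ⋆
    copI : IsCopStar I n e
    am-a : ap am a ≡ act M (sB bparal) (act M l m)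
    bm-b₁ : ap bm b₁ ≡ act M (tB bparal) (act M l m)
    bm-b₂ : ap bm b₂ ≡ act M (tB bparar) (act M r m)
    ia-e : ∀ i → ap ia (e i) ≡ act A (d i) a
    ib-e : ∀ i → ap ib (e i) ≡ act B (d i) b₁

data IsStar : Ob → Set where
  star : IsStar ⋆

record IsSync (C : Cospan) (n : ℕ) (i : Fin n) (m : ℕ) (j : Fin m) : Set₁ where
  open Cospan C
  field
    t : F M (τ n i m j)
    repM : IsRep M (τ n i m j) t
    pA : F A [ n ]
    qA : F A [ m ]
    bowA : IsBowtie A n i m j pA qA
    pB : F B [ n ]
    qB : F B [ m ]
    bowB : IsBowtie B n i m j pB qB
    -- I is the sub-presheaf of channels (of A, resp. of B, identified compatibly)
    I-chan : ∀ (c : Ob) → ¬ IsStar c → ¬ F I c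
    ia-inj : Injective _≡_ _≡_ (ap ia {⋆})
    ia-surj : ∀ (y : F A ⋆) → Σ (F I ⋆) (λ x → ap ia x ≡ y)
    ib-inj : Injective _≡_ _≡_ (ap ib {⋆})
    ib-surj : ∀ (y : F B ⋆) → Σ (F I ⋆) (λ x → ap ib x ≡ y)
    ib-p : ∀ (x : F I ⋆) (k : Fin n) → ap ia x ≡ act A (d k) pA → ap ib x ≡ act B (d k) pB
    ib-q : ∀ (x : F I ⋆) (k : Fin m) → ap ia x ≡ act A (d k) qA → ap ib x ≡ act B (d k) qB
    am-p : ap am pA ≡ act M (sB (bout i)) (act M (ε {n} {i} {m} {j}) t)
    am-q : ap am qA ≡ act M (sB (bin j)) (act M (ρ {n} {i} {m} {j}) t)
    bm-p : ap bm pB ≡ act M (tB (bout i)) (act M (ε {n} {i} {m} {j}) t)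
    bm-q : ap bm qB ≡ act M (tB (bin j)) (act M (ρ {n} {i} {m} {j}) t)

IsMove : Cospan → Set₁
IsMove C = (Σ ℕ λ n → Σ (BasicKind n) λ k → IsBasicMove C n k)
         ⊎ (Σ ℕ λ n → IsFork C n)
         ⊎ (Σ ℕ λ n → Σ (Fin n) λ i → Σ ℕ λ m → Σ (Fin m) λ j → IsSync C n i m j)

data IsPosOb : Ob → Set where
  pstar : IsPosOb ⋆
  pchan : ∀ n → IsPosOb [ n ]

Finite : Set → Set
Finite A = Σ ℕ λ k → A ↔ Fin k

record IsPosition (Z : Presheaf) : Set where
  field
    empty-else : ∀ (c : Ob) → ¬ IsPosOb c → ¬ F Z c
    fin⋆ : Finite (F Z ⋆)
    fin[] : ∀ n → Finite (F Z [ n ])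
    bound : Σ ℕ λ N → ∀ n → N ≤ n → ¬ F Z [ n ]

-- Extended moves: push a move (with interface I) out along I → Z, Z a position.
-- The result is the cospan  X --φ--> M' <--ψ-- Y  with
-- X = Z +_I A,  M' = Z +_I M,  Y = Z +_I B.

record IsExtMove {X M' Y : Presheaf} (φ : Mor X M') (ψ : Mor Y M') : Set₁ where
  field
    C : Cospan
  open Cospan C
  field
    move : IsMove C
    Z : Presheaf
    posZ : IsPosition Z
    f : Mor I Z
    aX : Mor A X
    zX : Mor Z X
    poX : IsPushout ia f aX zX
    mM : Mor M M'
    zM : Mor Z M'
    poM : IsPushout (am ∘ₘ ia) f mM zM
    bY : Mor B Y
    zY : Mor Z Y
    poY : IsPushout ib f bY zY
    φ-a : (φ ∘ₘ aX) ≈ₘ (mM ∘ₘ am)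
    φ-z : (φ ∘ₘ zX) ≈ₘ zM
    ψ-b : (ψ ∘ₘ bY) ≈ₘ (mM ∘ₘ bm)
    ψ-z : (ψ ∘ₘ zY) ≈ₘ zM

-- Chains  X_0 → M_0 ← X_1 → M_1 ← ⋯  of length L (just k: k moves; nothing: countable)

MIdx : Maybe ℕ → Set
MIdx (just k) = Fin k
MIdx nothing = ℕ

XIdx : Maybe ℕ → Set
XIdx (just k) = Fin (suc k)
XIdx nothing = ℕ

srcI : ∀ L → MIdx L → XIdx L
srcI (just k) i = inject₁ i
srcI nothing i = i

tgtI : ∀ L → MIdx L → XIdx L
tgtI (just k) i = Fin.suc i
  where import Data.Fin as Fin
tgtI nothing i = suc i

x0 : ∀ L → XIdx L
x0 (just k) = Fin.zero
  where import Data.Fin as Fin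
x0 nothing = zero

record IsChainColimit (L : Maybe ℕ) (X : XIdx L → Presheaf) (Mv : MIdx L → Presheaf)
         (φ : ∀ k → Mor (X (srcI L k)) (Mv k)) (ψ : ∀ k → Mor (X (tgtI L k)) (Mv k))
         (U : Presheaf) (xl : ∀ j → Mor (X j) U) (ml : ∀ k → Mor (Mv k) U) : Set₁ where
  field
    cocone-φ : ∀ k → (ml k ∘ₘ φ k) ≈ₘ xl (srcI L k)
    cocone-ψ : ∀ k → (ml k ∘ₘ ψ k) ≈ₘ xl (tgtI L k)
    exist : ∀ (W : Presheaf) (xs : ∀ j → Mor (X j) W) (ms : ∀ k → Mor (Mv k) W) →
            (∀ k → (ms k ∘ₘ φ k) ≈ₘ xs (srcI L k)) →
            (∀ k → (ms k ∘ₘ ψ k) ≈ₘ xs (tgtI L k)) →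
            Σ (Mor U W) λ h → (∀ j → (h ∘ₘ xl j) ≈ₘ xs j) × (∀ k → (h ∘ₘ ml k) ≈ₘ ms k)
    unique : ∀ (W : Presheaf) (h h' : Mor U W) →
             (∀ j → (h ∘ₘ xl j) ≈ₘ (h' ∘ₘ xl j)) →
             (∀ k → (h ∘ₘ ml k) ≈ₘ (h' ∘ₘ ml k)) → h ≈ₘ h'

record Play : Set₁ where
  field
    L  : Maybe ℕ
    X  : XIdx L → Presheaf
    Mv : MIdx L → Presheaf
    φ  : ∀ k → Mor (X (srcI L k)) (Mv k)
    ψ  : ∀ k → Mor (X (tgtI L k)) (Mv k)
    ext : ∀ k → IsExtMove (φ k) (ψ k)
    U  : Presheaf
    xl : ∀ j → Mor (X j) U
    ml : ∀ k → Mor (Mv k) U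
    colim : IsChainColimit L X Mv φ ψ U xl ml
    pos₀ : IsPosition (X (x0 L))
    mono : Monic (xl (x0 L))

  X₀ : Presheaf
  X₀ = X (x0 L)

  ι₀ : Mor X₀ U
  ι₀ = xl (x0 L)

record InE (X : Presheaf) : Set₁ where
  field
    play : Play
    toX  : Mor (Play.X₀ play) X

-- Full moves with initial position [n] (isomorphism classes), and U(M)

data FullMove (n : ℕ) : Set where
  fork : FullMove n
  input : Fin n → FullMove n
  output : Fin n → FullMove n
  tck : FullMove n
  chan : FullMove n

obF : ∀ {n} → FullMove n → Ob
obF {n} fork = para n
obF {n} (input i) = ι⁻ n i
obF {n} (output i) = ι⁺ n i
obF {n} tck = tick n
obF {n} chan = ν n

srcF : ∀ (U : Presheaf) {n} (M : FullMove n) → F U (obF M) → F U [ n ]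
srcF U fork x = act U (sB bparal) (act U l x)
srcF U (input i) x = act U (sB (bin i)) x
srcF U (output i) x = act U (sB (bout i)) x
srcF U tck x = act U (sB btick) x
srcF U chan x = act U sν x

srcMap : ∀ (U : Presheaf) →
         Σ ℕ (λ n → Σ (FullMove n) (λ M → F U (obF M))) → Σ ℕ (λ n → F U [ n ])
srcMap U (n , M , x) = n , srcF U M x

module Submission where

-- Injectivity is detected by a classifying presheaf.  Given a predicate on
-- the full-move elements of U ("marked" moves), the presheaf  Annotated
-- over U attaches to every player p ∈ U([n]) a mark: the marked full move
-- whose source is p, if any (and to move elements the marks of their
-- players).  A section  δ : U → Annotated  of the projection makes the
-- map  s  injective on marked moves, since  δ(s z)  carries the mark  z.
--
-- Sections are built through the chain  X₀ → M₀ ← X₁ → ⋯  defining U: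
--   * positions (all states X_j) have no move elements, so they lift with
--     empty marks; every move interface consists of channels only;
--   * a lift of the final position of an extended move extends uniquely to
--     the move (representables and pushouts of representables);
--   * a step counter  σ : U → StepCounter  records at which stage each move
--     element was played; marking the moves of stage < h, the lifts are
--     built backwards from stage h, and glue to  δ  by the colimit property.
-- Finally, two full moves with a common source are both marked for h large.

open import Defs
open import Relation.Binary.PropositionalEquality using (_≡_)
open import Function.Definitions using (Injective)
open import Relation.Binary.PropositionalEquality using (refl; sym; trans; cong; subst; module ≡-Reasoning)
open import Function using (_∘_)
open import Data.Nat using (ℕ; zero; suc; _≤_; _+_; _∸_; _≤?_)
open import Data.Nat.Properties using (≤-trans; n≤1+n; <⇒≱; m≤n⇒m∸n≡0; +-∸-assoc; ≰⇒>; m≤m+n; m≤n+m)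
open import Data.Bool using (Bool; true; false; if_then_else_)
open import Data.Maybe using (Maybe; just; nothing)
open import Data.Maybe.Properties using (just-injective)
open import Data.Product using (Σ; _×_; _,_; proj₁; proj₂)
open import Data.Product.Properties using (×-≡,≡→≡)
open import Data.Sum using (inj₁; inj₂)
open import Data.Unit using (⊤; tt)
open import Data.Empty using (⊥-elim)
open import Relation.Nullary using (¬_; Dec; yes; no; does)
open import Relation.Nullary.Decidable using (dec-true; dec-false)
open import Data.Fin using (Fin; toℕ) renaming (zero to fzero; suc to fsuc)
open import Data.Fin.Properties using (toℕ-inject₁)

identity : ∀ {P} → Mor P P
identity = record { ap = λ x → x ; nat = λ _ _ → refl }

nat₂ : ∀ {P Q a b c} (u : Mor P Q) (g₁ : Gen a b) (g₂ : Gen b c) (x : F P c) →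
       ap u (act P g₁ (act P g₂ x)) ≡ act Q g₁ (act Q g₂ (ap u x))
nat₂ {Q = Q} u g₁ g₂ x = trans (nat u g₁ _) (cong (act Q g₁) (nat u g₂ x))

srcF-natural : ∀ {P Q n} (u : Mor P Q) (M : FullMove n) (x : F P (obF M)) →
               ap u (srcF P M x) ≡ srcF Q M (ap u x)
srcF-natural u fork x = nat₂ u (sB bparal) l x
srcF-natural u (input i) x = nat u (sB (bin i)) x
srcF-natural u (output i) x = nat u (sB (bout i)) x
srcF-natural u tck x = nat u (sB btick) x
srcF-natural u chan x = nat u sν x

pushout-of-generics-ext :
  ∀ {S R₁ R₂ P W c₁ c₂ r₁ r₂} {f₁ : Mor S R₁} {f₂ : Mor S R₂} {i₁ : Mor R₁ P} {i₂ : Mor R₂ P} →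
  IsPushout f₁ f₂ i₁ i₂ → IsRep R₁ c₁ r₁ → IsRep R₂ c₂ r₂ → (h h' : Mor P W) →
  ap h (ap i₁ r₁) ≡ ap h' (ap i₁ r₁) → ap h (ap i₂ r₂) ≡ ap h' (ap i₂ r₂) → h ≈ₘ h'
pushout-of-generics-ext {W = W} {i₁ = i₁} {i₂} po rep₁ rep₂ h h' e₁ e₂ =
  IsPushout.unique po W h h'
    (IsRep.unique rep₁ W (h ∘ₘ i₁) (h' ∘ₘ i₁) e₁)
    (IsRep.unique rep₂ W (h ∘ₘ i₂) (h' ∘ₘ i₂) e₂)

parpar-ext : ∀ {B W n b₁ b₂} → IsParPar B n b₁ b₂ → (h h' : Mor B W) →
             ap h b₁ ≡ ap h' b₁ → ap h b₂ ≡ ap h' b₂ → h ≈ₘ h'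
parpar-ext pp h h' e₁ e₂ =
  pushout-of-generics-ext po rep₁ rep₂ h h'
    (subst (λ z → ap h z ≡ ap h' z) (sym i₁-r) e₁)
    (subst (λ z → ap h z ≡ ap h' z) (sym i₂-r) e₂)
  where open IsParPar pp

bowtie-ext : ∀ {B W n i m j p q} → IsBowtie B n i m j p q → (h h' : Mor B W) →
             ap h p ≡ ap h' p → ap h q ≡ ap h' q → h ≈ₘ h'
bowtie-ext bt h h' e₁ e₂ =
  pushout-of-generics-ext po repn repm h h'
    (subst (λ z → ap h z ≡ ap h' z) (sym iₙ-r) e₁)
    (subst (λ z → ap h z ≡ ap h' z) (sym iₘ-r) e₂)
  where open IsBowtie bt

-- A proposition-valued, decidable predicate on objects closed under
-- the generators defines a subterminal presheaf; a presheaf is supported on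
-- the sieve when it maps (necessarily uniquely) to it.

record Sieve : Set₁ where
  field
    Holds      : Ob → Set
    irrelevant : ∀ {c} (p q : Holds c) → p ≡ q
    closed     : ∀ {a b} → Gen a b → Holds b → Holds a
    decide     : (c : Ob) → Dec (Holds c)

module _ (S : Sieve) where
  open Sieve S

  subterminal : Presheaf
  subterminal = record
    { F = Holds ; act = closed
    ; relB = λ _ _ _ → irrelevant _ _ ; relν = λ _ _ → irrelevant _ _
    ; rellr = λ _ → irrelevant _ _ ; relτ = λ _ → irrelevant _ _ }

  Supported : Presheaf → Set
  Supported P = Mor P subterminal

  supported-unique : ∀ {P} (f g : Supported P) → f ≈ₘ g
  supported-unique f g c x = irrelevant _ _

  empty-outside⇒supported : ∀ {P} → (∀ c → ¬ Holds c → ¬ F P c) → Supported P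
  empty-outside⇒supported {P} empty = record { ap = λ {c} → inside c (decide c) ; nat = λ _ _ → irrelevant _ _ }
    where
    inside : ∀ c → Dec (Holds c) → F P c → Holds c
    inside c (yes p) x = p
    inside c (no ¬p) x = ⊥-elim (empty c ¬p x)

  rep-supported : ∀ {P c p} → IsRep P c p → Holds c → Supported P
  rep-supported rep h = proj₁ (IsRep.exist rep subterminal h)

  pushout-supported : ∀ {S' A C P} {f : Mor S' A} {g : Mor S' C} {i : Mor A P} {j : Mor C P} →
                      IsPushout f g i j → Supported A → Supported C → Supported P
  pushout-supported {f = f} {g} po sa sc =
    proj₁ (IsPushout.exist po subterminal sa sc (supported-unique (sa ∘ₘ f) (sc ∘ₘ g)))

posOb-irrelevant : ∀ {c} (p q : IsPosOb c) → p ≡ q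
posOb-irrelevant pstar pstar = refl
posOb-irrelevant (pchan n) (pchan .n) = refl

posOb-closed : ∀ {a b} → Gen a b → IsPosOb b → IsPosOb a
posOb-closed (d _) _ = pstar
posOb-closed (sB _) _ = pchan _
posOb-closed (tB _) _ = pchan _
posOb-closed sν _ = pchan _
posOb-closed tν _ = pchan _
posOb-closed l ()
posOb-closed r ()
posOb-closed ε ()
posOb-closed ρ ()

isPosOb? : (c : Ob) → Dec (IsPosOb c)
isPosOb? ⋆ = yes pstar
isPosOb? [ n ] = yes (pchan n)
isPosOb? (tick _) = no λ ()
isPosOb? (paral _) = no λ ()
isPosOb? (parar _) = no λ ()
isPosOb? (ν _) = no λ ()
isPosOb? (para _) = no λ ()
isPosOb? (ι⁺ _ _) = no λ ()
isPosOb? (ι⁻ _ _) = no λ ()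
isPosOb? (τ _ _ _ _) = no λ ()

Positional : Sieve
Positional = record { Holds = IsPosOb ; irrelevant = posOb-irrelevant ; closed = posOb-closed ; decide = isPosOb? }

-- The channel sieve: the object ⋆ alone (no generator ends in ⋆).

star-irrelevant : ∀ {c} (p q : IsStar c) → p ≡ q
star-irrelevant star star = refl

obB-notStar : ∀ {n} (c : Bas n) → ¬ IsStar (obB c)
obB-notStar btick ()
obB-notStar bparal ()
obB-notStar bparar ()
obB-notStar (bout _) ()
obB-notStar (bin _) ()

noArrowInto⋆ : ∀ {a b} → Gen a b → ¬ IsStar b
noArrowInto⋆ (d _) ()
noArrowInto⋆ (sB c) = obB-notStar c
noArrowInto⋆ (tB c) = obB-notStar c
noArrowInto⋆ sν ()
noArrowInto⋆ tν ()
noArrowInto⋆ l ()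
noArrowInto⋆ r ()
noArrowInto⋆ ε ()
noArrowInto⋆ ρ ()

isStar? : (c : Ob) → Dec (IsStar c)
isStar? ⋆ = yes star
isStar? [ _ ] = no λ ()
isStar? (tick _) = no λ ()
isStar? (paral _) = no λ ()
isStar? (parar _) = no λ ()
isStar? (ν _) = no λ ()
isStar? (para _) = no λ ()
isStar? (ι⁺ _ _) = no λ ()
isStar? (ι⁻ _ _) = no λ ()
isStar? (τ _ _ _ _) = no λ ()

Channels : Sieve
Channels = record
  { Holds = IsStar ; irrelevant = star-irrelevant
  ; closed = λ g p → ⊥-elim (noArrowInto⋆ g p) ; decide = isStar? }

position-positional : ∀ {Z} → IsPosition Z → Supported Positional Z
position-positional pos = empty-outside⇒supported Positional (IsPosition.empty-else pos)

full-not-positional : ∀ {n} (M : FullMove n) → ¬ IsPosOb (obF M)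
full-not-positional fork ()
full-not-positional (input _) ()
full-not-positional (output _) ()
full-not-positional tck ()
full-not-positional chan ()

interface-channels : ∀ {C} → IsMove C → Supported Channels (Cospan.I C)
interface-channels (inj₁ (_ , _ , mv)) =
  proj₁ (IsCopStar.exist (IsBasicMove.copI mv) (subterminal Channels) (λ _ → star))
interface-channels (inj₂ (inj₁ (_ , mv))) =
  proj₁ (IsCopStar.exist (IsFork.copI mv) (subterminal Channels) (λ _ → star))
interface-channels (inj₂ (inj₂ (_ , _ , _ , _ , mv))) =
  empty-outside⇒supported Channels (IsSync.I-chan mv)

-- the final position of a move is a representable [n'], n|n or n⋈m
move-target-positional : ∀ {C} → IsMove C → Supported Positional (Cospan.B C)
move-target-positional (inj₁ (_ , _ , mv)) = rep-supported Positional (IsBasicMove.repB mv) (pchan _)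
move-target-positional (inj₂ (inj₁ (_ , mv))) =
  pushout-supported Positional po (rep-supported Positional rep₁ (pchan _)) (rep-supported Positional rep₂ (pchan _))
  where open IsParPar (IsFork.parB mv)
move-target-positional (inj₂ (inj₂ (_ , _ , _ , _ , mv))) =
  pushout-supported Positional po (rep-supported Positional repn (pchan _)) (rep-supported Positional repm (pchan _))
  where open IsBowtie (IsSync.bowB mv)

-- the state after an extended move is a pushout of a move target and a position
extMove-target-positional : ∀ {X M' Y} {φ : Mor X M'} {ψ : Mor Y M'} → IsExtMove φ ψ → Supported Positional Y
extMove-target-positional E =
  pushout-supported Positional poY (move-target-positional move) (position-positional posZ)
  where open IsExtMove E

data StateView (L : Maybe ℕ) : XIdx L → Set where
  initial : StateView L (x0 L)
  after   : (k : MIdx L) → StateView L (tgtI L k)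

stateView : ∀ L j → StateView L j
stateView (just N) fzero = initial
stateView (just N) (fsuc k) = after k
stateView nothing zero = initial
stateView nothing (suc k) = after k

data NextMove (L : Maybe ℕ) : XIdx L → Set where
  next  : (k : MIdx L) → NextMove L (srcI L k)
  final : ∀ {j} → NextMove L j

nextMoveFin : ∀ N (j : Fin (suc N)) → NextMove (just N) j
nextMoveFin zero fzero = final
nextMoveFin (suc N) fzero = next fzero
nextMoveFin (suc N) (fsuc j) with nextMoveFin N j
... | next k = next (fsuc k)
... | final = final

nextMove : ∀ L j → NextMove L j
nextMove (just N) j = nextMoveFin N j
nextMove nothing j = next j

nextMoveFin-src : ∀ N (k : Fin N) → nextMoveFin N (srcI (just N) k) ≡ next k
nextMoveFin-src (suc N) fzero = refl
nextMoveFin-src (suc N) (fsuc k) rewrite nextMoveFin-src N k = refl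

nextMove-src : ∀ L k → nextMove L (srcI L k) ≡ next k
nextMove-src (just N) k = nextMoveFin-src N k
nextMove-src nothing k = refl

stage : ∀ L → MIdx L → ℕ
stage (just N) k = toℕ k
stage nothing k = k

stateNo : ∀ L → XIdx L → ℕ
stateNo (just N) j = toℕ j
stateNo nothing j = j

stateNo-src : ∀ L k → stateNo L (srcI L k) ≡ stage L k
stateNo-src (just N) k = toℕ-inject₁ k
stateNo-src nothing k = refl

stateNo-tgt : ∀ L k → stateNo L (tgtI L k) ≡ suc (stage L k)
stateNo-tgt (just N) k = refl
stateNo-tgt nothing k = refl

Steps : Ob → Set
Steps c = if does (isPosOb? c) then ⊤ else ℕ

steps-act : ∀ {a b} → Gen a b → Steps b → Steps a
steps-act (d _) _ = tt
steps-act (sB _) _ = tt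
steps-act (tB _) _ = tt
steps-act sν _ = tt
steps-act tν _ = tt
steps-act l v = v
steps-act r v = v
steps-act ε v = v
steps-act ρ v = v

StepCounter : Presheaf
StepCounter = record
  { F = Steps ; act = steps-act
  ; relB = λ _ _ _ → refl ; relν = λ _ _ → refl ; rellr = λ _ → refl ; relτ = λ _ → refl }

constantly : ℕ → (c : Ob) → Steps c
constantly v c with isPosOb? c
... | yes _ = tt
... | no _ = v

constantly-natural : ∀ v {a b} (g : Gen a b) → constantly v a ≡ steps-act g (constantly v b)
constantly-natural v (d _) = refl
constantly-natural v (sB _) = refl
constantly-natural v (tB _) = refl
constantly-natural v sν = refl
constantly-natural v tν = refl
constantly-natural v l = refl
constantly-natural v r = refl
constantly-natural v ε = refl
constantly-natural v ρ = refl

stampAll : ∀ P → ℕ → Mor P StepCounter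
stampAll P v = record { ap = λ {c} _ → constantly v c ; nat = λ g _ → constantly-natural v g }

constantly-positional : ∀ {c} v w → IsPosOb c → constantly v c ≡ constantly w c
constantly-positional v w pstar = refl
constantly-positional v w (pchan _) = refl

stamps-agree : ∀ {P Q} v w → Supported Positional P → (θ : Mor P Q) → (stampAll Q w ∘ₘ θ) ≈ₘ stampAll P v
stamps-agree v w sp θ c x = constantly-positional w v (ap sp x)

stepOf : ∀ {U n} → Mor U StepCounter → (M : FullMove n) → F U (obF M) → ℕ
stepOf σ fork x = ap σ x
stepOf σ (input _) x = ap σ x
stepOf σ (output _) x = ap σ x
stepOf σ tck x = ap σ x
stepOf σ chan x = ap σ x

module Marking (U : Presheaf) (marked : ∀ {n} (M : FullMove n) → F U (obF M) → Bool) where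

  Mark : Set
  Mark = Maybe (Σ ℕ λ n → Σ (FullMove n) λ M → F U (obF M))

  mark : ∀ {n} (M : FullMove n) → F U (obF M) → Mark
  mark {n} M x = if marked M x then just (n , M , x) else nothing

  mark-marked : ∀ {n} (M : FullMove n) (x : F U (obF M)) → marked M x ≡ true → mark M x ≡ just (n , M , x)
  mark-marked M x eq = cong (λ b → if b then just _ else nothing) eq

  mark-unmarked : ∀ {n} (M : FullMove n) (x : F U (obF M)) → marked M x ≡ false → mark M x ≡ nothing
  mark-unmarked M x eq = cong (λ b → if b then just _ else nothing) eq

  -- A player carries the marked full move it is the source of; a move
  -- element carries the marks of its final players, and paral/parar also
  -- the mark of their initial player.
  Marks : Ob → Set
  Marks ⋆ = ⊤
  Marks [ _ ] = Mark
  Marks (tick _) = Mark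
  Marks (ν _) = Mark
  Marks (ι⁺ _ _) = Mark
  Marks (ι⁻ _ _) = Mark
  Marks (paral _) = Mark × Mark
  Marks (parar _) = Mark × Mark
  Marks (para _) = Mark × Mark
  Marks (τ _ _ _ _) = Mark × Mark

  -- restriction of marks; s of a full move computes the move's own mark
  marksAct : ∀ {a b} → Gen a b → F U b → Marks b → Marks a
  marksAct (d _) _ _ = tt
  marksAct (sB btick) x _ = mark tck x
  marksAct (tB btick) _ μ = μ
  marksAct (sB bparal) _ (μs , _) = μs
  marksAct (tB bparal) _ (_ , μt) = μt
  marksAct (sB bparar) _ (μs , _) = μs
  marksAct (tB bparar) _ (_ , μt) = μt
  marksAct (sB (bout i)) x _ = mark (output i) x
  marksAct (tB (bout _)) _ μ = μ
  marksAct (sB (bin i)) x _ = mark (input i) x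
  marksAct (tB (bin _)) _ μ = μ
  marksAct sν x _ = mark chan x
  marksAct tν _ μ = μ
  marksAct l x (μl , _) = mark fork x , μl
  marksAct r x (_ , μr) = mark fork x , μr
  marksAct ε _ (μo , _) = μo
  marksAct ρ _ (_ , μi) = μi

  annotatedAct : ∀ {a b} → Gen a b → F U b × Marks b → F U a × Marks a
  annotatedAct g (x , μ) = act U g x , marksAct g x μ

  Annotated : Presheaf
  Annotated = record
    { F = λ c → F U c × Marks c ; act = annotatedAct
    ; relB = λ c i w → cong (_, tt) (relB U c i (proj₁ w))
    ; relν = λ i w → cong (_, tt) (relν U i (proj₁ w))
    ; rellr = λ w → cong (_, mark fork (proj₁ w)) (rellr U (proj₁ w))
    ; relτ = λ w → cong (_, tt) (relτ U (proj₁ w)) }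

  forget : Mor Annotated U
  forget = record { ap = proj₁ ; nat = λ _ _ → refl }

  marks-of-source : ∀ {n} (M : FullMove n) (w : F Annotated (obF M)) →
                    proj₂ (srcF Annotated M w) ≡ mark M (proj₁ w)
  marks-of-source fork w = refl
  marks-of-source (input _) w = refl
  marks-of-source (output _) w = refl
  marks-of-source tck w = refl
  marks-of-source chan w = refl

  record Lift {P : Presheaf} (f : Mor P U) : Set where
    field
      mor  : Mor P Annotated
      over : (forget ∘ₘ mor) ≈ₘ f
  open Lift public

  relift : ∀ {P} {f f' : Mor P U} → f ≈ₘ f' → Lift f' → Lift f
  relift f≈f' u = record { mor = mor u ; over = λ c x → trans (over u c x) (sym (f≈f' c x)) }

  restrict : ∀ {P Q} {f : Mor P U} {f' : Mor Q U} (θ : Mor Q P) → (f ∘ₘ θ) ≈ₘ f' → Lift f → Lift f'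
  restrict θ eq u = record { mor = mor u ∘ₘ θ ; over = λ c x → trans (over u c (ap θ x)) (eq c x) }

  Extension : ∀ {B M} (b : Mor B M) (f : Mor M U) → Lift (f ∘ₘ b) → Set
  Extension b f g = Σ (Lift f) λ u → (mor u ∘ₘ b) ≈ₘ mor g

  Silent : ∀ {P} → Mor P U → Set
  Silent {P} f = ∀ {n} (M : FullMove n) (x : F P (obF M)) → mark M (ap f x) ≡ nothing

  unmarked : (c : Ob) → Marks c
  unmarked ⋆ = tt
  unmarked [ _ ] = nothing
  unmarked (tick _) = nothing
  unmarked (ν _) = nothing
  unmarked (ι⁺ _ _) = nothing
  unmarked (ι⁻ _ _) = nothing
  unmarked (paral _) = nothing , nothing
  unmarked (parar _) = nothing , nothing
  unmarked (para _) = nothing , nothing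
  unmarked (τ _ _ _ _) = nothing , nothing

  unmarked-act : ∀ {P a b} (f : Mor P U) → Silent f → (g : Gen a b) (x : F P b) →
                 unmarked a ≡ marksAct g (ap f x) (unmarked b)
  unmarked-act f s (d _) x = refl
  unmarked-act f s (sB btick) x = sym (s tck x)
  unmarked-act f s (tB btick) x = refl
  unmarked-act f s (sB bparal) x = refl
  unmarked-act f s (tB bparal) x = refl
  unmarked-act f s (sB bparar) x = refl
  unmarked-act f s (tB bparar) x = refl
  unmarked-act f s (sB (bout i)) x = sym (s (output i) x)
  unmarked-act f s (tB (bout _)) x = refl
  unmarked-act f s (sB (bin i)) x = sym (s (input i) x)
  unmarked-act f s (tB (bin _)) x = refl
  unmarked-act f s sν x = sym (s chan x)
  unmarked-act f s tν x = refl
  unmarked-act f s l x = cong (_, nothing) (sym (s fork x))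
  unmarked-act f s r x = cong (_, nothing) (sym (s fork x))
  unmarked-act f s ε x = refl
  unmarked-act f s ρ x = refl

  plain : ∀ {P} (f : Mor P U) → Silent f → Lift f
  plain f s = record
    { mor = record { ap = λ {c} x → ap f x , unmarked c
                   ; nat = λ g x → ×-≡,≡→≡ (nat f g x , unmarked-act f s g x) }
    ; over = λ _ _ → refl }

  plain-natural : ∀ {P Q} {f : Mor P U} {f' : Mor Q U} (s : Silent f) (s' : Silent f') (θ : Mor Q P) →
                  (f ∘ₘ θ) ≈ₘ f' → (mor (plain f s) ∘ₘ θ) ≈ₘ mor (plain f' s')
  plain-natural s s' θ eq c x = cong (_, unmarked c) (eq c x)

  positional-silent : ∀ {P} → Supported Positional P → (f : Mor P U) → Silent f
  positional-silent sp f M x = ⊥-elim (full-not-positional M (ap sp x))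

  lift-generic : ∀ {M c m} → IsRep M c m → (f : Mor M U) (μ : Marks c) →
                 Σ (Lift f) λ u → ap (mor u) m ≡ (ap f m , μ)
  lift-generic {m = m} rep f μ =
    record { mor = u ; over = IsRep.unique rep U (forget ∘ₘ u) f (cong proj₁ um) } , um
    where
    u = proj₁ (IsRep.exist rep Annotated (ap f m , μ))
    um = proj₂ (IsRep.exist rep Annotated (ap f m , μ))

  agree-by-marks : ∀ {B M c} {f : Mor M U} (b : Mor B M) (u : Lift f) (g : Lift (f ∘ₘ b)) (y : F B c) →
                   proj₂ (ap (mor u) (ap b y)) ≡ proj₂ (ap (mor g) y) → ap (mor u) (ap b y) ≡ ap (mor g) y
  agree-by-marks b u g y eq = ×-≡,≡→≡ (trans (over u _ (ap b y)) (sym (over g _ y)) , eq)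

  -- Extending lifts over the three kinds of moves: the generic move element
  -- carries the marks of the final players.

  targetMarks : ∀ {n} (k : BasicKind n) → Mark → Marks (obK k)
  targetMarks (bas btick) μ = μ
  targetMarks (bas bparal) μ = nothing , μ
  targetMarks (bas bparar) μ = nothing , μ
  targetMarks (bas (bout _)) μ = μ
  targetMarks (bas (bin _)) μ = μ
  targetMarks new μ = μ

  targetMarks-read : ∀ {n} (k : BasicKind n) (x : F U (obK k)) (μ : Mark) →
                     marksAct (tK k) x (targetMarks k μ) ≡ μ
  targetMarks-read (bas btick) x μ = refl
  targetMarks-read (bas bparal) x μ = refl
  targetMarks-read (bas bparar) x μ = refl
  targetMarks-read (bas (bout _)) x μ = refl
  targetMarks-read (bas (bin _)) x μ = refl
  targetMarks-read new x μ = refl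

  extend-basic : ∀ {C n k} → IsBasicMove C n k → (f : Mor (Cospan.M C) U) (g : Lift (f ∘ₘ Cospan.bm C)) →
                 Extension (Cospan.bm C) f g
  extend-basic {C} {k = k} mv f g =
    u , IsRep.unique repB Annotated (mor u ∘ₘ bm) (mor g)
          (agree-by-marks bm u g b (trans (cong proj₂ at-b) (targetMarks-read k (ap f m) μ)))
    where
    open Cospan C
    open IsBasicMove mv
    μ = proj₂ (ap (mor g) b)
    generic = lift-generic repM f (targetMarks k μ)
    u = proj₁ generic
    at-b : ap (mor u) (ap bm b) ≡ annotatedAct (tK k) (ap f m , targetMarks k μ)
    at-b = trans (cong (ap (mor u)) bm-b) (trans (nat (mor u) (tK k) m) (cong (annotatedAct (tK k)) (proj₂ generic)))

  extend-fork : ∀ {C n} → IsFork C n → (f : Mor (Cospan.M C) U) (g : Lift (f ∘ₘ Cospan.bm C)) →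
                Extension (Cospan.bm C) f g
  extend-fork {C} mv f g =
    u , parpar-ext parB (mor u ∘ₘ bm) (mor g)
          (agree-by-marks bm u g b₁ (cong proj₂ at-b₁)) (agree-by-marks bm u g b₂ (cong proj₂ at-b₂))
    where
    open Cospan C
    open IsFork mv
    μ = proj₂ (ap (mor g) b₁) , proj₂ (ap (mor g) b₂)
    generic = lift-generic repM f μ
    u = proj₁ generic
    at-b₁ : ap (mor u) (ap bm b₁) ≡ annotatedAct (tB bparal) (annotatedAct l (ap f m , μ))
    at-b₁ = trans (cong (ap (mor u)) bm-b₁) (trans (nat₂ (mor u) (tB bparal) l m)
              (cong (annotatedAct (tB bparal) ∘ annotatedAct l) (proj₂ generic)))
    at-b₂ : ap (mor u) (ap bm b₂) ≡ annotatedAct (tB bparar) (annotatedAct r (ap f m , μ))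
    at-b₂ = trans (cong (ap (mor u)) bm-b₂) (trans (nat₂ (mor u) (tB bparar) r m)
              (cong (annotatedAct (tB bparar) ∘ annotatedAct r) (proj₂ generic)))

  extend-sync : ∀ {C n i m j} → IsSync C n i m j → (f : Mor (Cospan.M C) U) (g : Lift (f ∘ₘ Cospan.bm C)) →
                Extension (Cospan.bm C) f g
  extend-sync {C} {i = i} {j = j} mv f g =
    u , bowtie-ext bowB (mor u ∘ₘ bm) (mor g)
          (agree-by-marks bm u g pB (cong proj₂ at-p)) (agree-by-marks bm u g qB (cong proj₂ at-q))
    where
    open Cospan C
    open IsSync mv
    μ = proj₂ (ap (mor g) pB) , proj₂ (ap (mor g) qB)
    generic = lift-generic repM f μ
    u = proj₁ generic
    at-p : ap (mor u) (ap bm pB) ≡ annotatedAct (tB (bout i)) (annotatedAct ε (ap f t , μ))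
    at-p = trans (cong (ap (mor u)) bm-p) (trans (nat₂ (mor u) (tB (bout i)) ε t)
             (cong (annotatedAct (tB (bout i)) ∘ annotatedAct ε) (proj₂ generic)))
    at-q : ap (mor u) (ap bm qB) ≡ annotatedAct (tB (bin j)) (annotatedAct ρ (ap f t , μ))
    at-q = trans (cong (ap (mor u)) bm-q) (trans (nat₂ (mor u) (tB (bin j)) ρ t)
             (cong (annotatedAct (tB (bin j)) ∘ annotatedAct ρ) (proj₂ generic)))

  extend-move : ∀ {C} → IsMove C → (f : Mor (Cospan.M C) U) (g : Lift (f ∘ₘ Cospan.bm C)) →
                Extension (Cospan.bm C) f g
  extend-move (inj₁ (_ , _ , mv)) = extend-basic mv
  extend-move (inj₂ (inj₁ (_ , mv))) = extend-fork mv
  extend-move (inj₂ (inj₂ (_ , _ , _ , _ , mv))) = extend-sync mv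

  -- Channels carry no marks, so lifts agree on them as soon as they agree in U.
  channel-agree : ∀ {c} → IsStar c → (w w' : F Annotated c) → proj₁ w ≡ proj₁ w' → w ≡ w'
  channel-agree star w w' eq = ×-≡,≡→≡ (eq , refl)

  -- Extending over an extended move: glue the extension over the move with
  -- the given lift on the context Z, which agree on the channel interface.
  extend-extMove : ∀ {X M' Y} {φ : Mor X M'} {ψ : Mor Y M'} → IsExtMove φ ψ →
                   (f : Mor M' U) (g : Lift (f ∘ₘ ψ)) → Extension ψ f g
  extend-extMove {ψ = ψ} E f g = record { mor = glued ; over = glued-over } , glued-restricts
    where
    open IsExtMove E renaming (f to attach)
    open Cospan C
    g-final : Lift ((f ∘ₘ mM) ∘ₘ bm)
    g-final = restrict bY (λ c x → cong (ap f) (ψ-b c x)) g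
    onMove : Extension bm (f ∘ₘ mM) g-final
    onMove = extend-move move (f ∘ₘ mM) g-final
    u = proj₁ onMove
    compat : (mor u ∘ₘ (am ∘ₘ ia)) ≈ₘ ((mor g ∘ₘ zY) ∘ₘ attach)
    compat c x = channel-agree (ap (interface-channels move) x) _ _ (begin
      proj₁ (ap (mor u) (ap am (ap ia x)))    ≡⟨ over u c _ ⟩
      ap f (ap mM (ap am (ap ia x)))          ≡⟨ cong (ap f) (IsPushout.commute poM c x) ⟩
      ap f (ap zM (ap attach x))              ≡⟨ cong (ap f) (sym (ψ-z c _)) ⟩
      ap f (ap ψ (ap zY (ap attach x)))       ≡⟨ sym (over g c _) ⟩
      proj₁ (ap (mor g) (ap zY (ap attach x))) ∎)
      where open ≡-Reasoning
    glue = IsPushout.exist poM Annotated (mor u) (mor g ∘ₘ zY) compat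
    glued = proj₁ glue
    on-M = proj₁ (proj₂ glue)
    on-Z = proj₂ (proj₂ glue)
    glued-over : (forget ∘ₘ glued) ≈ₘ f
    glued-over = IsPushout.unique poM U (forget ∘ₘ glued) f
      (λ c x → trans (cong proj₁ (on-M c x)) (over u c x))
      (λ c x → trans (cong proj₁ (on-Z c x)) (trans (over g c _) (cong (ap f) (ψ-z c x))))
    glued-restricts : (glued ∘ₘ ψ) ≈ₘ mor g
    glued-restricts = IsPushout.unique poY Annotated (glued ∘ₘ ψ) (mor g)
      (λ c x → trans (cong (ap glued) (ψ-b c x)) (trans (on-M c _) (proj₂ onMove c x)))
      (λ c x → trans (cong (ap glued) (ψ-z c x)) (on-Z c x))

module Chain (P : Play) where
  open Play P

  state-positional : ∀ j → Supported Positional (X j)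
  state-positional j with stateView L j
  ... | initial = position-positional pos₀
  ... | after k = extMove-target-positional (ext k)

  stamp = IsChainColimit.exist colim StepCounter
            (λ j → stampAll (X j) 0) (λ k → stampAll (Mv k) (suc (stage L k)))
            (λ k → stamps-agree _ _ (state-positional _) (φ k))
            (λ k → stamps-agree _ _ (state-positional _) (ψ k))

  σ : Mor U StepCounter
  σ = proj₁ stamp

  σ-move : ∀ k {n} (M : FullMove n) (x : F (Mv k) (obF M)) → stepOf σ M (ap (ml k) x) ≡ suc (stage L k)
  σ-move k fork x = proj₂ (proj₂ stamp) k _ x
  σ-move k (input _) x = proj₂ (proj₂ stamp) k _ x
  σ-move k (output _) x = proj₂ (proj₂ stamp) k _ x
  σ-move k tck x = proj₂ (proj₂ stamp) k _ x
  σ-move k chan x = proj₂ (proj₂ stamp) k _ x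

  module Truncated (h : ℕ) where

    marked : ∀ {n} (M : FullMove n) → F U (obF M) → Bool
    marked M x = does (stepOf σ M x ≤? h)

    open Marking U marked public

    mark-early : ∀ {n} (M : FullMove n) (x : F U (obF M)) → stepOf σ M x ≤ h → mark M x ≡ just (n , M , x)
    mark-early M x le = mark-marked M x (dec-true (_ ≤? h) le)

    late-silent : ∀ k → h ≤ stage L k → Silent (ml k)
    late-silent k late M x = mark-unmarked M _ (dec-false (_ ≤? h)
      (λ le → <⇒≱ (subst (_≤ h) (σ-move k M x) le) late))

    base-silent : ∀ j → Silent (xl j)
    base-silent j = positional-silent (state-positional j) (xl j)

    base : ∀ j → Lift (xl j)
    base j = plain (xl j) (base-silent j)

    extension-at : ∀ k (g : Lift (xl (tgtI L k))) →
                   Extension (ψ k) (ml k) (relift (IsChainColimit.cocone-ψ colim k) g)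
    extension-at k g = extend-extMove (ext k) (ml k) (relift (IsChainColimit.cocone-ψ colim k) g)

    extend-at : ∀ k → Lift (xl (tgtI L k)) → Lift (ml k)
    extend-at k g = proj₁ (extension-at k g)

    pull-back : ∀ k → Lift (ml k) → Lift (xl (srcI L k))
    pull-back k = restrict (φ k) (IsChainColimit.cocone-φ colim k)

    -- the lift of X_j marking the full moves of the next e moves
    ahead : ℕ → ∀ j → Lift (xl j)
    ahead zero j = base j
    ahead (suc e) j = ahead-step (ahead e) (nextMove L j)
      where
      ahead-step : (∀ j → Lift (xl j)) → ∀ {j} → NextMove L j → Lift (xl j)
      ahead-step later (next k) = pull-back k (extend-at k (later (tgtI L k)))
      ahead-step later final = base _

    ahead-src : ∀ e k → mor (ahead (suc e) (srcI L k)) ≈ₘ (mor (extend-at k (ahead e (tgtI L k))) ∘ₘ φ k)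
    ahead-src e k rewrite nextMove-src L k = λ _ _ → refl

    fuel : ∀ {e e'} j → e ≡ e' → mor (ahead e j) ≈ₘ mor (ahead e' j)
    fuel j refl _ _ = refl

    stateLift : ∀ j → Lift (xl j)
    stateLift j = ahead (h ∸ stateNo L j) j

    moveLift : ∀ k → Dec (h ≤ stage L k) → Lift (ml k)
    moveLift k (yes late) = plain (ml k) (late-silent k late)
    moveLift k (no early) = extend-at k (ahead (h ∸ suc (stage L k)) (tgtI L k))

    lift-φ : ∀ k dec → (mor (moveLift k dec) ∘ₘ φ k) ≈ₘ mor (stateLift (srcI L k))
    lift-φ k (yes late) c x =
      trans (plain-natural {f = ml k} {f' = xl (srcI L k)} (late-silent k late) (base-silent _) (φ k) (IsChainColimit.cocone-φ colim k) c x)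
            (fuel (srcI L k) (sym (trans (cong (h ∸_) (stateNo-src L k)) (m≤n⇒m∸n≡0 late))) c x)
    lift-φ k (no early) c x =
      sym (trans (fuel (srcI L k) (trans (cong (h ∸_) (stateNo-src L k)) (+-∸-assoc 1 (≰⇒> early))) c x)
                 (ahead-src (h ∸ suc (stage L k)) k c x))

    lift-ψ : ∀ k dec → (mor (moveLift k dec) ∘ₘ ψ k) ≈ₘ mor (stateLift (tgtI L k))
    lift-ψ k (yes late) c x =
      trans (plain-natural {f = ml k} {f' = xl (tgtI L k)} (late-silent k late) (base-silent _) (ψ k) (IsChainColimit.cocone-ψ colim k) c x)
            (fuel (tgtI L k) (sym (trans (cong (h ∸_) (stateNo-tgt L k)) (m≤n⇒m∸n≡0 (≤-trans late (n≤1+n _))))) c x)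
    lift-ψ k (no early) c x =
      trans (proj₂ (extension-at k later) c x) (fuel (tgtI L k) (cong (h ∸_) (sym (stateNo-tgt L k))) c x)
      where later = ahead (h ∸ suc (stage L k)) (tgtI L k)

    section = IsChainColimit.exist colim Annotated
                (λ j → mor (stateLift j)) (λ k → mor (moveLift k (h ≤? stage L k)))
                (λ k → lift-φ k (h ≤? stage L k)) (λ k → lift-ψ k (h ≤? stage L k))

    δ : Mor U Annotated
    δ = proj₁ section

    δ-section : (forget ∘ₘ δ) ≈ₘ identity
    δ-section = IsChainColimit.unique colim U (forget ∘ₘ δ) identity
      (λ j c x → trans (cong proj₁ (proj₁ (proj₂ section) j c x)) (over (stateLift j) c x))
      (λ k c x → trans (cong proj₁ (proj₂ (proj₂ section) k c x)) (over (moveLift k (h ≤? stage L k)) c x))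

    sourceMark : Σ ℕ (λ n → F U [ n ]) → Mark
    sourceMark (n , p) = proj₂ (ap δ p)

    sourceMark-src : ∀ {n} (M : FullMove n) (x : F U (obF M)) → sourceMark (srcMap U (n , M , x)) ≡ mark M x
    sourceMark-src M x = begin
      proj₂ (ap δ (srcF U M x))              ≡⟨ cong proj₂ (srcF-natural δ M x) ⟩
      proj₂ (srcF Annotated M (ap δ x))      ≡⟨ marks-of-source M (ap δ x) ⟩
      mark M (proj₁ (ap δ x))                ≡⟨ cong (mark M) (δ-section _ x) ⟩
      mark M x                               ∎
      where open ≡-Reasoning

mainTheorem6 : ∀ (X : Presheaf) → IsPosition X → (E : InE X) →
    Injective _≡_ _≡_ (srcMap (Play.U (InE.play E)))
mainTheorem6 X posX E {n , M , x} {n' , M' , y} same-source = just-injective (begin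
  just (n , M , x)                  ≡⟨ sym (mark-early M x (m≤m+n _ _)) ⟩
  mark M x                          ≡⟨ sym (sourceMark-src M x) ⟩
  sourceMark (srcMap U (n , M , x))   ≡⟨ cong sourceMark same-source ⟩
  sourceMark (srcMap U (n' , M' , y)) ≡⟨ sourceMark-src M' y ⟩
  mark M' y                         ≡⟨ mark-early M' y (m≤n+m _ _) ⟩
  just (n' , M' , y)                ∎)
  where
  open ≡-Reasoning
  open Play (InE.play E) using (U)
  open Chain (InE.play E)
  -- a stage bound covering both moves
  h = stepOf σ M x + stepOf σ M' y
  open Truncated h
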